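{- Let $n\ge1$. Whenever the variables satisfy $u_1=x_{11}y_{11}$, $u_3=x_{12}y_{12}$, $v_1=x_2+y_2$ and $u_2v_2=x_{12}y_{12}x_2+x_{11}y_{11}y_2$, one has $$G_{n+1}(x_{11},x_{12},x_2;y_{11},y_{12},y_2)=M_n(u_1,u_2,u_3;v_1,v_2).$$
   Context: A plane tree is an unlabeled rooted tree in which the children of every vertex are linearly ordered from left to right; $\mathcal P_n$ is the set of plane trees with $n$ edges. A leaf is a vertex with no children, an interior vertex one with at least one child. In a plane tree: a leaf without siblings is a singleton leaf; a leaf with siblings is an elder leaf if it is the leftmost child of its parent, and a young leaf otherwise; an interior vertex is a young interior vertex if it is not the parent of a singleton leaf or of an elder leaf. For $T\in\mathcal P_n$ let $\mathrm{sleaf},\mathrm{eleaf},\mathrm{yleaf}$ count singleton, elder, young leaves, $\mathrm{sint},\mathrm{eint}$ count parents of singleton leaves and parents of elder leaves, $\mathrm{yint}$ counts young interior vertices. For $n\ge2$, $G_n(x_{11},x_{12},x_2;y_{11},y_{12},y_2)=\sum_{T\in\mathcal P_n}x_{11}^{\mathrm{sleaf}(T)}x_{12}^{\mathrm{eleaf}(T)}x_2^{\mathrm{yleaf}(T)}y_{11}^{\mathrm{sint}(T)}y_{12}^{\mathrm{eint}(T)}y_2^{\mathrm{yint}(T)}$. A tip-augmented plane tree is a plane tree in which the leftmost child of every interior vertex is a leaf; $\mathcal T_m$ is the set of those with $m$ edges. In such a tree: a leaf without siblings is a singleton leaf; a leaf with siblings that is the leftmost child is an elder twin leaf if the second child of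 its parent is a leaf and an elder non-twin leaf otherwise; a leaf with siblings that is the second child is a second leaf; a leaf with siblings that is neither first nor second child is a younger leaf; $\mathrm{sleaf},\mathrm{etleaf},\mathrm{entleaf},\mathrm{syleaf},\mathrm{yerleaf}$ count these. For $n\ge1$, $M_n(u_1,u_2,u_3;v_1,v_2)=\sum_{T\in\mathcal T_{n+1}}u_1^{\mathrm{sleaf}(T)}u_2^{\mathrm{etleaf}(T)}u_3^{\mathrm{entleaf}(T)}v_1^{\mathrm{yerleaf}(T)}v_2^{\mathrm{syleaf}(T)}$. -}

module Defs where

open import Level using (Level)
open import Data.Nat using (ℕ; zero; suc) renaming (_+_ to _+ℕ_)
open import Data.List using (List; []; _∷_)
open import Data.List.Membership.Propositional using (_∈_)
open import Data.List.Relation.Unary.Unique.Propositional using (Unique)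
open import Data.Product using (_×_)
open import Algebra.Bundles using (CommutativeRing)

-- Plane trees: a vertex is given by the (left-to-right ordered) list of
-- its subtrees.  A leaf is  node [] .

data PTree : Set where
  node : List PTree → PTree

leaf : PTree
leaf = node []

mutual
  edges : PTree → ℕ
  edges (node cs) = edgesL cs

  edgesL : List PTree → ℕ
  edgesL [] = 0
  edgesL (c ∷ cs) = suc (edges c) +ℕ edgesL cs

mutual
  vsum : (List PTree → ℕ) → PTree → ℕ
  vsum f (node cs) = f cs +ℕ vsumL f cs

  vsumL : (List PTree → ℕ) → List PTree → ℕ
  vsumL f [] = 0
  vsumL f (c ∷ cs) = vsum f c +ℕ vsumL f cs

leavesIn : List PTree → ℕ
leavesIn [] = 0
leavesIn (node [] ∷ cs) = suc (leavesIn cs)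
leavesIn (node (_ ∷ _) ∷ cs) = leavesIn cs

-- the vertex has exactly one child, which is a leaf (a singleton leaf);
-- equivalently the vertex is a parent of a singleton leaf
singletonLeafChild : List PTree → ℕ
singletonLeafChild (node [] ∷ []) = 1
singletonLeafChild _ = 0

-- the leftmost child is a leaf and has siblings (an elder leaf);
-- equivalently the vertex is a parent of an elder leaf
elderLeafChild : List PTree → ℕ
elderLeafChild (node [] ∷ _ ∷ _) = 1
elderLeafChild _ = 0

youngLeafChildren : List PTree → ℕ
youngLeafChildren [] = 0
youngLeafChildren (_ ∷ cs) = leavesIn cs

-- interior vertex that is neither parent of a singleton leaf nor of an
-- elder leaf (i.e. its leftmost child is interior)
youngInterior : List PTree → ℕ
youngInterior [] = 0
youngInterior (node [] ∷ _) = 0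
youngInterior (node (_ ∷ _) ∷ _) = 1

sleaf eleaf yleaf sint eint yint : PTree → ℕ
sleaf = vsum singletonLeafChild
eleaf = vsum elderLeafChild
yleaf = vsum youngLeafChildren
sint  = vsum singletonLeafChild
eint  = vsum elderLeafChild
yint  = vsum youngInterior

mutual
  data TipAug : PTree → Set where
    tip : ∀ {cs} → LeftmostLeaf cs → AllTipAug cs → TipAug (node cs)

  data AllTipAug : List PTree → Set where
    []  : AllTipAug []
    _∷_ : ∀ {c cs} → TipAug c → AllTipAug cs → AllTipAug (c ∷ cs)

  data LeftmostLeaf : List PTree → Set where
    noChildren : LeftmostLeaf []
    leafFirst  : ∀ {cs} → LeftmostLeaf (node [] ∷ cs)

elderTwinLeafChild : List PTree → ℕ
elderTwinLeafChild (node [] ∷ node [] ∷ _) = 1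
elderTwinLeafChild _ = 0

elderNonTwinLeafChild : List PTree → ℕ
elderNonTwinLeafChild (node [] ∷ node (_ ∷ _) ∷ _) = 1
elderNonTwinLeafChild _ = 0

secondLeafChild : List PTree → ℕ
secondLeafChild (_ ∷ node [] ∷ _) = 1
secondLeafChild _ = 0

youngerLeafChildren : List PTree → ℕ
youngerLeafChildren (_ ∷ _ ∷ cs) = leavesIn cs
youngerLeafChildren _ = 0

etleaf entleaf syleaf yerleaf : PTree → ℕ
etleaf  = vsum elderTwinLeafChild
entleaf = vsum elderNonTwinLeafChild
syleaf  = vsum secondLeafChild
yerleaf = vsum youngerLeafChildren

IsEnumeration : {A : Set} → (A → Set) → List A → Set
IsEnumeration P xs = (∀ t → P t → t ∈ xs) × (∀ t → t ∈ xs → P t) × Unique xs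

module _ {c ℓ : Level} (R : CommutativeRing c ℓ) where
  open CommutativeRing R

  pow : Carrier → ℕ → Carrier
  pow a zero = 1#
  pow a (suc k) = a * pow a k

  sumOver : {A : Set} → (A → Carrier) → List A → Carrier
  sumOver f [] = 0#
  sumOver f (t ∷ ts) = f t + sumOver f ts

  Gweight : (x11 x12 x2 y11 y12 y2 : Carrier) → PTree → Carrier
  Gweight x11 x12 x2 y11 y12 y2 T =
    pow x11 (sleaf T) * pow x12 (eleaf T) * pow x2 (yleaf T)
    * pow y11 (sint T) * pow y12 (eint T) * pow y2 (yint T)

  Mweight : (u1 u2 u3 v1 v2 : Carrier) → PTree → Carrier
  Mweight u1 u2 u3 v1 v2 T =
    pow u1 (sleaf T) * pow u2 (etleaf T) * pow u3 (entleaf T)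
    * pow v1 (yerleaf T) * pow v2 (syleaf T)

{-# OPTIONS --safe #-}
-- A plane tree T is sent to a tip-augmented tree Φ T with the same number of edges by lifting
-- its left spine into the root: if v₀, …, v_k is the left spine of T (v_k a leaf) and rs_i are
-- the children of v_i other than v_{i+1}, then the root of Φ T has the children
--   leaf, Φ* rs_{k-1}, leaf, Φ* rs_{k-2}, …, leaf, Φ* rs_0.
-- Conversely, a preimage of a tip-augmented tree is rebuilt by reading the children of its root
-- after the first one from left to right, deciding for every leaf among them whether it is a
-- young leaf of the current spine vertex or the separator that closes it, and choosing a
-- preimage of every interior child. Summed over these choices the G-weight factorises: a young
-- leaf weighs x₂ and a separator y₂ (the closed vertex becomes the leftmost child of a young
-- interior vertex), so such a leaf contributes x₂ + y₂ = v₁. The first of these children settles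
-- the bottom spine vertex v_{k-1}: it contributes x₁₁y₁₁ = u₁ if there is no such child,
-- x₁₂y₁₂x₂ + x₁₁y₁₁y₂ = u₂v₂ if it is a leaf, and x₁₂y₁₂ = u₃ times the fibre sum of the child
-- if it is interior. Hence every fibre of Φ sums to the M-weight of its image.
module Submission where

open import Defs
open import Data.Nat using (ℕ; suc; _≤_)
open import Data.List using (List)
open import Data.Product using (_×_)
open import Relation.Binary.PropositionalEquality using (_≡_)
open import Algebra.Bundles using (CommutativeRing)

open import Data.Nat as ℕ using (zero)
import Data.Nat.Properties as ℕₚ
open import Data.List using ([]; _∷_; _++_; [_]; concatMap)
open import Data.List.Properties using (++-assoc; ++-identityʳ; ++-identityʳ-unique; ++-cancelˡ; ∷-injectiveˡ)
open import Data.List.Membership.Propositional using (_∈_; find; lose)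
open import Data.List.Membership.Propositional.Properties
  using (∈-++⁺ˡ; ∈-++⁺ʳ; ∈-++⁻; ∈-concatMap⁺; ∈-concatMap⁻)
open import Data.List.Membership.Propositional.Properties.WithK using (unique∧set⇒bag)
open import Data.List.Relation.Binary.BagAndSetEquality using (∼bag⇒↭)
open import Data.List.Relation.Binary.Permutation.Propositional as ↭ using (_↭_)
open import Data.List.Relation.Unary.Any using (here; there)
open import Data.List.Relation.Unary.All as All using ([])
import Data.List.Relation.Unary.All.Properties as All
import Data.List.Relation.Unary.AllPairs as AllPairs
import Data.List.Relation.Unary.AllPairs.Properties as AllPairs
open import Data.List.Relation.Unary.Unique.Propositional using (Unique; []; _∷_)
open import Data.List.Relation.Unary.Unique.Propositional.Properties using (++⁺; concat⁺)
open import Data.Product using (∃-syntax; _,_; proj₁; proj₂)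
open import Data.Sum using (inj₁; inj₂)
open import Data.Empty using (⊥; ⊥-elim)
open import Relation.Nullary using (¬_)
open import Function using (_∘_; _⇔_; mk⇔)
open import Relation.Unary using (_≐_)
open import Relation.Binary.PropositionalEquality using (refl; sym; trans; cong; cong₂; subst; module ≡-Reasoning)
import Algebra.Properties.CommutativeSemigroup as CommutativeSemigroupProperties
import Algebra.Solver.Ring.NaturalCoefficients.Default as NaturalCoefficientsSolver
import Relation.Binary.Reasoning.Setoid as SetoidReasoning

module _ {A B : Set} (f : A → List B) where

  ∈-concatMap⁺′ : ∀ {xs x y} → x ∈ xs → y ∈ f x → y ∈ concatMap f xs
  ∈-concatMap⁺′ x∈xs y∈fx = ∈-concatMap⁺ f (lose x∈xs y∈fx)

  ∈-concatMap⁻′ : ∀ xs {y} → y ∈ concatMap f xs → ∃[ x ] x ∈ xs × y ∈ f x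
  ∈-concatMap⁻′ xs y∈ = find (∈-concatMap⁻ f y∈)

  Unique-concatMap : ∀ {xs} → Unique xs → (∀ x → Unique (f x)) →
                     (∀ {x x′ y} → y ∈ f x → y ∈ f x′ → x ≡ x′) →
                     Unique (concatMap f xs)
  Unique-concatMap xs! f! separated =
    concat⁺ (All.map⁺ (All.tabulate λ {x} _ → f! x))
            (AllPairs.map⁺ (AllPairs.map (λ x≢x′ {y} (y∈fx , y∈fx′) → x≢x′ (separated y∈fx y∈fx′)) xs!))

module _ {c ℓ} (R : CommutativeRing c ℓ) where
  open CommutativeRing R renaming (refl to ≈-refl; sym to ≈-sym; trans to ≈-trans)
  open CommutativeSemigroupProperties +-commutativeSemigroup using (x∙yz≈y∙xz)

  sumOver-++ : ∀ {A : Set} (f : A → Carrier) xs ys →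
               sumOver R f (xs ++ ys) ≈ sumOver R f xs + sumOver R f ys
  sumOver-++ f []       ys = ≈-sym (+-identityˡ _)
  sumOver-++ f (x ∷ xs) ys = ≈-trans (+-congˡ (sumOver-++ f xs ys)) (≈-sym (+-assoc _ _ _))

  sumOver-concatMap : ∀ {A B : Set} (f : B → Carrier) (g : A → List B) xs →
                      sumOver R f (concatMap g xs) ≈ sumOver R (λ x → sumOver R f (g x)) xs
  sumOver-concatMap f g []       = ≈-refl
  sumOver-concatMap f g (x ∷ xs) =
    ≈-trans (sumOver-++ f (g x) (concatMap g xs)) (+-congˡ (sumOver-concatMap f g xs))

  sumOver-cong : ∀ {A : Set} {f g : A → Carrier} xs → (∀ {x} → x ∈ xs → f x ≈ g x) →
                 sumOver R f xs ≈ sumOver R g xs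
  sumOver-cong []       f≈g = ≈-refl
  sumOver-cong (x ∷ xs) f≈g = +-cong (f≈g (here refl)) (sumOver-cong xs (f≈g ∘ there))

  sumOver-*ʳ : ∀ {A : Set} (f : A → Carrier) k xs →
               sumOver R (λ x → f x * k) xs ≈ sumOver R f xs * k
  sumOver-*ʳ f k []       = ≈-sym (zeroˡ k)
  sumOver-*ʳ f k (x ∷ xs) = ≈-trans (+-congˡ (sumOver-*ʳ f k xs)) (≈-sym (distribʳ k (f x) _))

  sumOver-↭ : ∀ {A : Set} (f : A → Carrier) {xs ys} → xs ↭ ys → sumOver R f xs ≈ sumOver R f ys
  sumOver-↭ f ↭.refl                = ≈-refl
  sumOver-↭ f (↭.prep x xs↭ys)      = +-congˡ (sumOver-↭ f xs↭ys)
  sumOver-↭ f (↭.swap x y xs↭ys)    = ≈-trans (+-congˡ (+-congˡ (sumOver-↭ f xs↭ys))) (x∙yz≈y∙xz _ _ _)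
  sumOver-↭ f (↭.trans xs↭ys ys↭zs) = ≈-trans (sumOver-↭ f xs↭ys) (sumOver-↭ f ys↭zs)

  sumOver-enumeration : ∀ {A : Set} {P : A → Set} (f : A → Carrier) {xs ys} →
                        IsEnumeration P xs → IsEnumeration P ys → sumOver R f xs ≈ sumOver R f ys
  sumOver-enumeration f {xs} {ys} (xs-complete , xs-sound , xs!) (ys-complete , ys-sound , ys!) =
    sumOver-↭ f (∼bag⇒↭ (unique∧set⇒bag xs! ys! same-elements))
    where
    same-elements : ∀ {x} → (x ∈ xs ⇔ x ∈ ys)
    same-elements = mk⇔ (λ x∈xs → ys-complete _ (xs-sound _ x∈xs)) (λ x∈ys → xs-complete _ (ys-sound _ x∈ys))

  module _ {A B : Set} {P : A → Set} {Q : B → Set} (Φ : A → B) (Φ⁻¹ : B → List A)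
           (fibres : ∀ y → IsEnumeration (λ x → Φ x ≡ y) (Φ⁻¹ y)) (P≐Q∘Φ : P ≐ Q ∘ Φ) where

    concatMap-fibres : ∀ {ys} → IsEnumeration Q ys → IsEnumeration P (concatMap Φ⁻¹ ys)
    concatMap-fibres {ys} (ys-complete , ys-sound , ys!) = complete , sound , unique
      where
      complete : ∀ x → P x → x ∈ concatMap Φ⁻¹ ys
      complete x Px = ∈-concatMap⁺′ Φ⁻¹ (ys-complete (Φ x) (proj₁ P≐Q∘Φ Px)) (proj₁ (fibres (Φ x)) x refl)

      sound : ∀ x → x ∈ concatMap Φ⁻¹ ys → P x
      sound x x∈ with y , y∈ys , x∈Φ⁻¹y ← ∈-concatMap⁻′ Φ⁻¹ ys x∈ =
        proj₂ P≐Q∘Φ (subst Q (sym (proj₁ (proj₂ (fibres y)) x x∈Φ⁻¹y)) (ys-sound y y∈ys))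

      unique : Unique (concatMap Φ⁻¹ ys)
      unique = Unique-concatMap Φ⁻¹ ys! (λ y → proj₂ (proj₂ (fibres y)))
                 (λ {y} {y′} {x} x∈Φ⁻¹y x∈Φ⁻¹y′ →
                    trans (sym (proj₁ (proj₂ (fibres y)) x x∈Φ⁻¹y)) (proj₁ (proj₂ (fibres y′)) x x∈Φ⁻¹y′))

    sumOver-fibres : ∀ (f : A → Carrier) {xs ys} → IsEnumeration P xs → IsEnumeration Q ys →
                     sumOver R f xs ≈ sumOver R (λ y → sumOver R f (Φ⁻¹ y)) ys
    sumOver-fibres f {ys = ys} xs-enum ys-enum =
      ≈-trans (sumOver-enumeration f xs-enum (concatMap-fibres ys-enum)) (sumOver-concatMap f Φ⁻¹ ys)

mutual
  Φ : PTree → PTree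
  Φ (node [])       = leaf
  Φ (node (c ∷ rs)) = node (leaf ∷ flattenSpine c rs)

  flattenSpine : PTree → List PTree → List PTree
  flattenSpine (node [])       rs = Φ* rs
  flattenSpine (node (d ∷ ds)) rs = flattenSpine d ds ++ leaf ∷ Φ* rs

  Φ* : List PTree → List PTree
  Φ* []       = []
  Φ* (t ∷ rs) = Φ t ∷ Φ* rs

edgesL-++ : ∀ xs ys → edgesL (xs ++ ys) ≡ edgesL xs ℕ.+ edgesL ys
edgesL-++ []       ys = refl
edgesL-++ (x ∷ xs) ys =
  trans (cong (suc (edges x) ℕ.+_) (edgesL-++ xs ys)) (sym (ℕₚ.+-assoc (suc (edges x)) (edgesL xs) (edgesL ys)))

mutual
  edges-Φ : ∀ T → edges (Φ T) ≡ edges T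
  edges-Φ (node [])       = refl
  edges-Φ (node (c ∷ rs)) = cong suc (edges-flattenSpine c rs)

  edges-flattenSpine : ∀ c rs → edgesL (flattenSpine c rs) ≡ edges c ℕ.+ edgesL rs
  edges-flattenSpine (node [])       rs = edges-Φ* rs
  edges-flattenSpine (node (d ∷ ds)) rs = begin
    edgesL (flattenSpine d ds ++ leaf ∷ Φ* rs)          ≡⟨ edgesL-++ (flattenSpine d ds) (leaf ∷ Φ* rs) ⟩
    edgesL (flattenSpine d ds) ℕ.+ suc (edgesL (Φ* rs)) ≡⟨ cong₂ (λ m n → m ℕ.+ suc n) (edges-flattenSpine d ds) (edges-Φ* rs) ⟩
    (edges d ℕ.+ edgesL ds) ℕ.+ suc (edgesL rs)         ≡⟨ ℕₚ.+-suc (edges d ℕ.+ edgesL ds) (edgesL rs) ⟩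
    suc (edges d ℕ.+ edgesL ds) ℕ.+ edgesL rs           ∎
    where open ≡-Reasoning

  edges-Φ* : ∀ rs → edgesL (Φ* rs) ≡ edgesL rs
  edges-Φ* []       = refl
  edges-Φ* (t ∷ rs) = cong₂ (λ m n → suc m ℕ.+ n) (edges-Φ t) (edges-Φ* rs)

leaf-tipAug : TipAug leaf
leaf-tipAug = tip noChildren []

AllTipAug-++ : ∀ {xs ys} → AllTipAug xs → AllTipAug ys → AllTipAug (xs ++ ys)
AllTipAug-++ []       ys = ys
AllTipAug-++ (x ∷ xs) ys = x ∷ AllTipAug-++ xs ys

mutual
  Φ-tipAug : ∀ T → TipAug (Φ T)
  Φ-tipAug (node [])       = leaf-tipAug
  Φ-tipAug (node (c ∷ rs)) = tip leafFirst (leaf-tipAug ∷ flattenSpine-tipAug c rs)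

  flattenSpine-tipAug : ∀ c rs → AllTipAug (flattenSpine c rs)
  flattenSpine-tipAug (node [])       rs = Φ*-tipAug rs
  flattenSpine-tipAug (node (d ∷ ds)) rs = AllTipAug-++ (flattenSpine-tipAug d ds) (leaf-tipAug ∷ Φ*-tipAug rs)

  Φ*-tipAug : ∀ rs → AllTipAug (Φ* rs)
  Φ*-tipAug []       = []
  Φ*-tipAug (t ∷ rs) = Φ-tipAug t ∷ Φ*-tipAug rs

-- grow c rs L lists the preimages of node (leaf ∷ flattenSpine c rs ++ L) in which the spine
-- vertex under construction has children c ∷ rs so far: a leaf of L either becomes its next
-- child or closes it, an interior tree of L becomes its next child through any of its preimages.
mutual
  Φ⁻¹ : PTree → List PTree
  Φ⁻¹ (node [])                 = leaf ∷ []
  Φ⁻¹ (node (node [] ∷ L))      = grow leaf [] L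
  Φ⁻¹ (node (node (_ ∷ _) ∷ _)) = []

  grow : PTree → List PTree → List PTree → List PTree
  grow c rs []                     = node (c ∷ rs) ∷ []
  grow c rs (node [] ∷ L)          = grow c (rs ++ [ leaf ]) L ++ grow (node (c ∷ rs)) [] L
  grow c rs (d@(node (_ ∷ _)) ∷ L) = concatMap (λ t → grow c (rs ++ [ t ]) L) (Φ⁻¹ d)

Φ*-++ : ∀ rs xs → Φ* (rs ++ xs) ≡ Φ* rs ++ Φ* xs
Φ*-++ []       xs = refl
Φ*-++ (t ∷ rs) xs = cong (Φ t ∷_) (Φ*-++ rs xs)

flattenSpine-++ : ∀ c rs xs → flattenSpine c (rs ++ xs) ≡ flattenSpine c rs ++ Φ* xs
flattenSpine-++ (node [])       rs xs = Φ*-++ rs xs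
flattenSpine-++ (node (d ∷ ds)) rs xs = begin
  flattenSpine d ds ++ leaf ∷ Φ* (rs ++ xs)     ≡⟨ cong (λ ys → flattenSpine d ds ++ leaf ∷ ys) (Φ*-++ rs xs) ⟩
  flattenSpine d ds ++ leaf ∷ Φ* rs ++ Φ* xs    ≡⟨ ++-assoc (flattenSpine d ds) (leaf ∷ Φ* rs) (Φ* xs) ⟨
  (flattenSpine d ds ++ leaf ∷ Φ* rs) ++ Φ* xs  ∎
  where open ≡-Reasoning

flattenSpine-snoc : ∀ c rs t L → flattenSpine c (rs ++ [ t ]) ++ L ≡ flattenSpine c rs ++ Φ t ∷ L
flattenSpine-snoc c rs t L =
  trans (cong (_++ L) (flattenSpine-++ c rs [ t ])) (++-assoc (flattenSpine c rs) [ Φ t ] L)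

mutual
  Φ-grow : ∀ c rs L {Y} → Y ∈ grow c rs L → Φ Y ≡ node (leaf ∷ flattenSpine c rs ++ L)
  Φ-grow c rs [] (here refl) = cong (node ∘ (leaf ∷_)) (sym (++-identityʳ (flattenSpine c rs)))
  Φ-grow c rs (node [] ∷ L) Y∈ with ∈-++⁻ (grow c (rs ++ [ leaf ]) L) Y∈
  ... | inj₁ Y∈ = trans (Φ-grow c (rs ++ [ leaf ]) L Y∈) (cong (node ∘ (leaf ∷_)) (flattenSpine-snoc c rs leaf L))
  ... | inj₂ Y∈ = trans (Φ-grow (node (c ∷ rs)) [] L Y∈) (cong (node ∘ (leaf ∷_)) (++-assoc (flattenSpine c rs) [ leaf ] L))
  Φ-grow c rs (d@(node (_ ∷ _)) ∷ L) Y∈ =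
    let t , t∈Φ⁻¹d , Y∈ = ∈-concatMap⁻′ (λ t → grow c (rs ++ [ t ]) L) (Φ⁻¹ d) Y∈ in
    trans (Φ-grow c (rs ++ [ t ]) L Y∈)
          (cong (node ∘ (leaf ∷_)) (trans (flattenSpine-snoc c rs t L)
                                          (cong (λ e → flattenSpine c rs ++ e ∷ L) (Φ⁻¹-sound t∈Φ⁻¹d))))

  Φ⁻¹-sound : ∀ {T Y} → Y ∈ Φ⁻¹ T → Φ Y ≡ T
  Φ⁻¹-sound {node []}            (here refl) = refl
  Φ⁻¹-sound {node (node [] ∷ L)} Y∈          = Φ-grow leaf [] L Y∈

grow-reassoc : ∀ c rs₀ r rs L {Y} → Y ∈ grow c (rs₀ ++ r ∷ rs) L → Y ∈ grow c ((rs₀ ++ [ r ]) ++ rs) L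
grow-reassoc c rs₀ r rs L = subst (λ xs → _ ∈ grow c xs L) (sym (++-assoc rs₀ [ r ] rs))

mutual
  Φ⁻¹-complete : ∀ Y → Y ∈ Φ⁻¹ (Φ Y)
  Φ⁻¹-complete (node [])       = here refl
  Φ⁻¹-complete (node (c ∷ rs)) =
    subst (λ L → node (c ∷ rs) ∈ grow leaf [] L) (++-identityʳ (flattenSpine c rs))
          (grow-flattenSpine c rs [] (here refl))

  grow-Φ* : ∀ c rs₀ rs L {Y} → Y ∈ grow c (rs₀ ++ rs) L → Y ∈ grow c rs₀ (Φ* rs ++ L)
  grow-Φ* c rs₀ []                     L Y∈ = subst (λ xs → _ ∈ grow c xs L) (++-identityʳ rs₀) Y∈
  grow-Φ* c rs₀ (node [] ∷ rs)         L Y∈ =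
    ∈-++⁺ˡ (grow-Φ* c (rs₀ ++ [ leaf ]) rs L (grow-reassoc c rs₀ leaf rs L Y∈))
  grow-Φ* c rs₀ (r@(node (_ ∷ _)) ∷ rs) L Y∈ =
    ∈-concatMap⁺′ (λ t → grow c (rs₀ ++ [ t ]) (Φ* rs ++ L)) (Φ⁻¹-complete r)
                  (grow-Φ* c (rs₀ ++ [ r ]) rs L (grow-reassoc c rs₀ r rs L Y∈))

  grow-flattenSpine : ∀ c rs L {Y} → Y ∈ grow c rs L → Y ∈ grow leaf [] (flattenSpine c rs ++ L)
  grow-flattenSpine (node [])       rs L Y∈ = grow-Φ* leaf [] rs L Y∈
  grow-flattenSpine (node (d ∷ ds)) rs L Y∈ =
    subst (λ xs → _ ∈ grow leaf [] xs) (sym (++-assoc (flattenSpine d ds) (leaf ∷ Φ* rs) L))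
          (grow-flattenSpine d ds (leaf ∷ Φ* rs ++ L)
                             (∈-++⁺ʳ (grow d (ds ++ [ leaf ]) (Φ* rs ++ L)) (grow-Φ* (node (d ∷ ds)) [] rs L Y∈)))

data OnLeftSpine (cs : List PTree) : PTree → Set where
  here  : OnLeftSpine cs (node cs)
  there : ∀ {c rs} → OnLeftSpine cs c → OnLeftSpine cs (node (c ∷ rs))

onLeftSpine-edges : ∀ {cs T} → OnLeftSpine cs T → edgesL cs ≤ edges T
onLeftSpine-edges here              = ℕₚ.≤-refl
onLeftSpine-edges (there {c} {rs} p) =
  ℕₚ.≤-trans (onLeftSpine-edges p) (ℕₚ.≤-trans (ℕₚ.n≤1+n (edges c)) (ℕₚ.m≤m+n (suc (edges c)) (edgesL rs)))

¬onLeftSpine-leftChild : ∀ {c xs} → ¬ OnLeftSpine (c ∷ xs) c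
¬onLeftSpine-leftChild {c} {xs} p =
  ℕₚ.1+n≰n (ℕₚ.≤-trans (ℕₚ.m≤m+n (suc (edges c)) (edgesL xs)) (onLeftSpine-edges p))

onLeftSpine-unique : ∀ {c xs ys T} → OnLeftSpine (c ∷ xs) T → OnLeftSpine (c ∷ ys) T → xs ≡ ys
onLeftSpine-unique here      here      = refl
onLeftSpine-unique here      (there q) = ⊥-elim (¬onLeftSpine-leftChild q)
onLeftSpine-unique (there p) here      = ⊥-elim (¬onLeftSpine-leftChild p)
onLeftSpine-unique (there p) (there q) = onLeftSpine-unique p q

onLeftSpine-fromLeftChild : ∀ {cs xs T} → OnLeftSpine (node cs ∷ xs) T → OnLeftSpine cs T
onLeftSpine-fromLeftChild here      = there here
onLeftSpine-fromLeftChild (there p) = there (onLeftSpine-fromLeftChild p)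

onLeftSpine-++[] : ∀ {c} rs {T} → OnLeftSpine (c ∷ rs) T → OnLeftSpine (c ∷ rs ++ []) T
onLeftSpine-++[] rs = subst (λ xs → OnLeftSpine (_ ∷ xs) _) (sym (++-identityʳ rs))

onLeftSpine-reassoc : ∀ {c} rs t M {T} → OnLeftSpine (c ∷ (rs ++ [ t ]) ++ M) T → OnLeftSpine (c ∷ rs ++ t ∷ M) T
onLeftSpine-reassoc rs t M = subst (λ xs → OnLeftSpine (_ ∷ xs) _) (++-assoc rs [ t ] M)

-- The spine vertex under construction survives in every output of grow; as a left spine
-- vertex is determined by its leftmost child, this keeps the branches of grow apart.
grow-onLeftSpine : ∀ c rs L {Y} → Y ∈ grow c rs L → ∃[ M ] OnLeftSpine (c ∷ rs ++ M) Y
grow-onLeftSpine c rs [] (here refl) = [] , onLeftSpine-++[] rs here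
grow-onLeftSpine c rs (node [] ∷ L) Y∈ with ∈-++⁻ (grow c (rs ++ [ leaf ]) L) Y∈
... | inj₁ Y∈ = let M , p = grow-onLeftSpine c (rs ++ [ leaf ]) L Y∈ in
                leaf ∷ M , onLeftSpine-reassoc rs leaf M p
... | inj₂ Y∈ = let _ , p = grow-onLeftSpine (node (c ∷ rs)) [] L Y∈ in
                [] , onLeftSpine-++[] rs (onLeftSpine-fromLeftChild p)
grow-onLeftSpine c rs (d@(node (_ ∷ _)) ∷ L) Y∈ =
  let t , _ , Y∈ = ∈-concatMap⁻′ (λ t → grow c (rs ++ [ t ]) L) (Φ⁻¹ d) Y∈
      M , p      = grow-onLeftSpine c (rs ++ [ t ]) L Y∈
  in t ∷ M , onLeftSpine-reassoc rs t M p

grow-close-disjoint : ∀ c rs L {Y} → Y ∈ grow c (rs ++ [ leaf ]) L → Y ∈ grow (node (c ∷ rs)) [] L → ⊥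
grow-close-disjoint c rs L Y∈ Y∈′
  with M , p ← grow-onLeftSpine c (rs ++ [ leaf ]) L Y∈ | _ , q ← grow-onLeftSpine (node (c ∷ rs)) [] L Y∈′
  with () ← ++-identityʳ-unique rs (sym (onLeftSpine-unique (onLeftSpine-reassoc rs leaf M p) (onLeftSpine-fromLeftChild q)))

grow-child-determined : ∀ c rs L {t t′ Y} → Y ∈ grow c (rs ++ [ t ]) L → Y ∈ grow c (rs ++ [ t′ ]) L → t ≡ t′
grow-child-determined c rs L {t} {t′} Y∈ Y∈′
  with M , p ← grow-onLeftSpine c (rs ++ [ t ]) L Y∈ | M′ , q ← grow-onLeftSpine c (rs ++ [ t′ ]) L Y∈′ =
  ∷-injectiveˡ (++-cancelˡ rs (t ∷ M) (t′ ∷ M′)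
                 (onLeftSpine-unique (onLeftSpine-reassoc rs t M p) (onLeftSpine-reassoc rs t′ M′ q)))

mutual
  grow-unique : ∀ c rs L → Unique (grow c rs L)
  grow-unique c rs []                     = [] ∷ []
  grow-unique c rs (node [] ∷ L)          =
    ++⁺ (grow-unique c (rs ++ [ leaf ]) L) (grow-unique (node (c ∷ rs)) [] L)
        (λ (Y∈ , Y∈′) → grow-close-disjoint c rs L Y∈ Y∈′)
  grow-unique c rs (d@(node (_ ∷ _)) ∷ L) =
    Unique-concatMap (λ t → grow c (rs ++ [ t ]) L) (Φ⁻¹-unique d) (λ t → grow-unique c (rs ++ [ t ]) L)
                     (grow-child-determined c rs L)

  Φ⁻¹-unique : ∀ T → Unique (Φ⁻¹ T)
  Φ⁻¹-unique (node [])                 = [] ∷ []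
  Φ⁻¹-unique (node (node [] ∷ L))      = grow-unique leaf [] L
  Φ⁻¹-unique (node (node (_ ∷ _) ∷ _)) = []

Φ⁻¹-isEnumeration : ∀ T → IsEnumeration (λ Y → Φ Y ≡ T) (Φ⁻¹ T)
Φ⁻¹-isEnumeration T = complete , (λ _ → Φ⁻¹-sound) , Φ⁻¹-unique T
  where
  complete : ∀ Y → Φ Y ≡ T → Y ∈ Φ⁻¹ T
  complete Y refl = Φ⁻¹-complete Y

data NotSingletonParent : PTree → List PTree → Set where
  interiorFirst : ∀ {x xs rs} → NotSingletonParent (node (x ∷ xs)) rs
  hasSibling    : ∀ {c r rs} → NotSingletonParent c (r ∷ rs)

notSingletonParent-snoc : ∀ c rs t → NotSingletonParent c (rs ++ [ t ])
notSingletonParent-snoc c []      t = hasSibling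
notSingletonParent-snoc c (_ ∷ _) t = hasSibling

module _ {c ℓ} (R : CommutativeRing c ℓ) where
  open CommutativeRing R renaming (refl to ≈-refl; sym to ≈-sym; trans to ≈-trans)
  open CommutativeSemigroupProperties *-commutativeSemigroup using (interchange; x∙yz≈y∙xz; xy∙z≈y∙xz)
  open NaturalCoefficientsSolver commutativeSemiring using (solve; _:=_; _:+_; _:*_; con)
  open SetoidReasoning setoid

  productOver : {A : Set} → (A → Carrier) → List A → Carrier
  productOver f []       = 1#
  productOver f (x ∷ xs) = f x * productOver f xs

  productOver-snoc : ∀ {A : Set} (f : A → Carrier) xs x →
                     productOver f (xs ++ [ x ]) ≈ productOver f xs * f x
  productOver-snoc f []       x = *-comm (f x) 1#
  productOver-snoc f (y ∷ xs) x = ≈-trans (*-congˡ (productOver-snoc f xs x)) (≈-sym (*-assoc _ _ _))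

  productOver-* : ∀ {A : Set} (f g : A → Carrier) xs →
                  productOver (λ x → f x * g x) xs ≈ productOver f xs * productOver g xs
  productOver-* f g []       = ≈-sym (*-identityˡ 1#)
  productOver-* f g (x ∷ xs) = ≈-trans (*-congˡ (productOver-* f g xs)) (interchange _ _ _ _)

  pow-+ : ∀ x m n → pow R x (m ℕ.+ n) ≈ pow R x m * pow R x n
  pow-+ x zero    n = ≈-sym (*-identityˡ _)
  pow-+ x (suc m) n = ≈-trans (*-congˡ (pow-+ x m n)) (≈-sym (*-assoc _ _ _))

  Multiplicative : (List PTree → Carrier) → (PTree → Carrier) → Set ℓ
  Multiplicative local W = ∀ cs → W (node cs) ≈ local cs * productOver W cs

  pow-vsum-multiplicative : ∀ x f → Multiplicative (λ cs → pow R x (f cs)) (λ T → pow R x (vsum f T))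
  pow-vsum-multiplicative x f cs = ≈-trans (pow-+ x (f cs) (vsumL f cs)) (*-congˡ (pow-vsumL cs))
    where
    pow-vsumL : ∀ cs → pow R x (vsumL f cs) ≈ productOver (λ T → pow R x (vsum f T)) cs
    pow-vsumL []       = ≈-refl
    pow-vsumL (t ∷ cs) = ≈-trans (pow-+ x (vsum f t) (vsumL f cs)) (*-congˡ (pow-vsumL cs))

  *-multiplicative : ∀ {l l′ W W′} → Multiplicative l W → Multiplicative l′ W′ →
                     Multiplicative (λ cs → l cs * l′ cs) (λ T → W T * W′ T)
  *-multiplicative {l} {l′} {W} {W′} W-mult W′-mult cs = begin
    W (node cs) * W′ (node cs)                              ≈⟨ *-cong (W-mult cs) (W′-mult cs) ⟩
    (l cs * productOver W cs) * (l′ cs * productOver W′ cs) ≈⟨ interchange _ _ _ _ ⟩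
    (l cs * l′ cs) * (productOver W cs * productOver W′ cs) ≈⟨ *-congˡ (productOver-* W W′ cs) ⟨
    (l cs * l′ cs) * productOver (λ T → W T * W′ T) cs      ∎

  leafOr : Carrier → (PTree → Carrier) → PTree → Carrier
  leafOr x W (node [])         = x
  leafOr x W t@(node (_ ∷ _)) = W t

  productOver-leafOr : ∀ x W → W leaf ≈ 1# → ∀ cs →
                       pow R x (leavesIn cs) * productOver W cs ≈ productOver (leafOr x W) cs
  productOver-leafOr x W W-leaf []                      = *-identityˡ 1#
  productOver-leafOr x W W-leaf (node [] ∷ cs)          = begin
    x * pow R x (leavesIn cs) * (W leaf * productOver W cs) ≈⟨ *-congˡ (≈-trans (*-congʳ W-leaf) (*-identityˡ _)) ⟩
    x * pow R x (leavesIn cs) * productOver W cs            ≈⟨ *-assoc _ _ _ ⟩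
    x * (pow R x (leavesIn cs) * productOver W cs)          ≈⟨ *-congˡ (productOver-leafOr x W W-leaf cs) ⟩
    x * productOver (leafOr x W) cs                         ∎
  productOver-leafOr x W W-leaf (t@(node (_ ∷ _)) ∷ cs) = begin
    pow R x (leavesIn cs) * (W t * productOver W cs) ≈⟨ x∙yz≈y∙xz _ _ _ ⟩
    W t * (pow R x (leavesIn cs) * productOver W cs) ≈⟨ *-congˡ (productOver-leafOr x W W-leaf cs) ⟩
    W t * productOver (leafOr x W) cs                ∎

  leafOr-Φ⁻¹ : ∀ a W x xs {t} → t ∈ Φ⁻¹ (node (x ∷ xs)) → leafOr a W t ≡ W t
  leafOr-Φ⁻¹ a W x xs {node []}      t∈ with () ← Φ⁻¹-sound {node (x ∷ xs)} t∈
  leafOr-Φ⁻¹ a W x xs {node (_ ∷ _)} _  = refl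

  module Gweights (x11 x12 x2 y11 y12 y2 : Carrier) where

    private
      Gw φ : PTree → Carrier
      Gw = Gweight R x11 x12 x2 y11 y12 y2
      φ  = leafOr x2 Gw

    localG : List PTree → Carrier
    localG cs = pow R x11 (singletonLeafChild cs) * pow R x12 (elderLeafChild cs) * pow R x2 (youngLeafChildren cs)
              * pow R y11 (singletonLeafChild cs) * pow R y12 (elderLeafChild cs) * pow R y2 (youngInterior cs)

    Gweight-multiplicative : Multiplicative localG Gw
    Gweight-multiplicative =
      *-multiplicative (*-multiplicative (*-multiplicative (*-multiplicative (*-multiplicative
        (pow-vsum-multiplicative x11 singletonLeafChild) (pow-vsum-multiplicative x12 elderLeafChild))
        (pow-vsum-multiplicative x2 youngLeafChildren)) (pow-vsum-multiplicative y11 singletonLeafChild))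
        (pow-vsum-multiplicative y12 elderLeafChild)) (pow-vsum-multiplicative y2 youngInterior)

    Gweight-leaf : Gw leaf ≈ 1#
    Gweight-leaf = solve 0 (con 1 :* con 1 :* con 1 :* con 1 :* con 1 :* con 1 := con 1) ≈-refl

    Gweight-leftLeaf : ∀ cs → Gw (node (leaf ∷ cs)) ≈ localG (leaf ∷ cs) * productOver Gw cs
    Gweight-leftLeaf cs =
      ≈-trans (Gweight-multiplicative (leaf ∷ cs)) (*-congˡ (≈-trans (*-congʳ Gweight-leaf) (*-identityˡ _)))

    Gweight-singleton : Gw (node [ leaf ]) ≈ x11 * y11
    Gweight-singleton = ≈-trans (Gweight-leftLeaf [])
      (solve 2 (λ x y → x :* con 1 :* con 1 :* con 1 :* (y :* con 1) :* con 1 :* con 1 :* con 1 := x :* y)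
             ≈-refl x11 y11)

    Gweight-elder : ∀ r rs → Gw (node (leaf ∷ r ∷ rs)) ≈ x12 * y12 * productOver φ (r ∷ rs)
    Gweight-elder r rs = begin
      Gw (node (leaf ∷ r ∷ rs))
        ≈⟨ Gweight-leftLeaf (r ∷ rs) ⟩
      localG (leaf ∷ r ∷ rs) * productOver Gw (r ∷ rs)
        ≈⟨ solve 4 (λ x y p g → con 1 :* (x :* con 1) :* p :* con 1 :* (y :* con 1) :* con 1 :* g
                                  := x :* y :* (p :* g)) ≈-refl x12 y12 _ _ ⟩
      x12 * y12 * (pow R x2 (leavesIn (r ∷ rs)) * productOver Gw (r ∷ rs))
        ≈⟨ *-congˡ (productOver-leafOr x2 Gw Gweight-leaf (r ∷ rs)) ⟩
      x12 * y12 * productOver φ (r ∷ rs) ∎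

    Gweight-youngInterior : ∀ x xs rs →
                            Gw (node (node (x ∷ xs) ∷ rs)) ≈ y2 * Gw (node (x ∷ xs)) * productOver φ rs
    Gweight-youngInterior x xs rs = begin
      Gw (node (t ∷ rs))
        ≈⟨ Gweight-multiplicative (t ∷ rs) ⟩
      localG (t ∷ rs) * (Gw t * productOver Gw rs)
        ≈⟨ solve 4 (λ y w p g → con 1 :* con 1 :* p :* con 1 :* con 1 :* (y :* con 1) :* (w :* g)
                                  := y :* w :* (p :* g)) ≈-refl y2 (Gw t) _ _ ⟩
      y2 * Gw t * (pow R x2 (leavesIn rs) * productOver Gw rs)
        ≈⟨ *-congˡ (productOver-leafOr x2 Gw Gweight-leaf rs) ⟩
      y2 * Gw t * productOver φ rs ∎
      where t = node (x ∷ xs)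

    Gweight-snoc : ∀ {c rs} t → NotSingletonParent c rs → Gw (node (c ∷ rs ++ [ t ])) ≈ Gw (node (c ∷ rs)) * φ t
    Gweight-snoc {node (x ∷ xs)} {rs} t _ = begin
      Gw (node (node (x ∷ xs) ∷ rs ++ [ t ]))               ≈⟨ Gweight-youngInterior x xs (rs ++ [ t ]) ⟩
      y2 * Gw (node (x ∷ xs)) * productOver φ (rs ++ [ t ]) ≈⟨ *-congˡ (productOver-snoc φ rs t) ⟩
      y2 * Gw (node (x ∷ xs)) * (productOver φ rs * φ t)    ≈⟨ *-assoc _ _ _ ⟨
      y2 * Gw (node (x ∷ xs)) * productOver φ rs * φ t      ≈⟨ *-congʳ (Gweight-youngInterior x xs rs) ⟨
      Gw (node (node (x ∷ xs) ∷ rs)) * φ t                  ∎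
    Gweight-snoc {node []} {r ∷ rs} t hasSibling = begin
      Gw (node (leaf ∷ r ∷ rs ++ [ t ]))            ≈⟨ Gweight-elder r (rs ++ [ t ]) ⟩
      x12 * y12 * productOver φ ((r ∷ rs) ++ [ t ]) ≈⟨ *-congˡ (productOver-snoc φ (r ∷ rs) t) ⟩
      x12 * y12 * (productOver φ (r ∷ rs) * φ t)    ≈⟨ *-assoc _ _ _ ⟨
      x12 * y12 * productOver φ (r ∷ rs) * φ t      ≈⟨ *-congʳ (Gweight-elder r rs) ⟨
      Gw (node (leaf ∷ r ∷ rs)) * φ t               ∎

  module Mweights (u1 u2 u3 v1 v2 : Carrier) where

    private
      Mw ψ : PTree → Carrier
      Mw = Mweight R u1 u2 u3 v1 v2
      ψ  = leafOr v1 Mw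

    localM : List PTree → Carrier
    localM cs = pow R u1 (singletonLeafChild cs) * pow R u2 (elderTwinLeafChild cs) * pow R u3 (elderNonTwinLeafChild cs)
              * pow R v1 (youngerLeafChildren cs) * pow R v2 (secondLeafChild cs)

    Mweight-multiplicative : Multiplicative localM Mw
    Mweight-multiplicative =
      *-multiplicative (*-multiplicative (*-multiplicative (*-multiplicative
        (pow-vsum-multiplicative u1 singletonLeafChild) (pow-vsum-multiplicative u2 elderTwinLeafChild))
        (pow-vsum-multiplicative u3 elderNonTwinLeafChild)) (pow-vsum-multiplicative v1 youngerLeafChildren))
        (pow-vsum-multiplicative v2 secondLeafChild)

    Mweight-leaf : Mw leaf ≈ 1#
    Mweight-leaf = solve 0 (con 1 :* con 1 :* con 1 :* con 1 :* con 1 := con 1) ≈-refl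

    Mweight-leftLeaf : ∀ cs → Mw (node (leaf ∷ cs)) ≈ localM (leaf ∷ cs) * productOver Mw cs
    Mweight-leftLeaf cs =
      ≈-trans (Mweight-multiplicative (leaf ∷ cs)) (*-congˡ (≈-trans (*-congʳ Mweight-leaf) (*-identityˡ _)))

    Mweight-singleton : Mw (node [ leaf ]) ≈ u1
    Mweight-singleton = ≈-trans (Mweight-leftLeaf [])
      (solve 1 (λ u → u :* con 1 :* con 1 :* con 1 :* con 1 :* con 1 :* con 1 := u) ≈-refl u1)

    Mweight-twin : ∀ L → Mw (node (leaf ∷ leaf ∷ L)) ≈ u2 * v2 * productOver ψ L
    Mweight-twin L = begin
      Mw (node (leaf ∷ leaf ∷ L))
        ≈⟨ Mweight-leftLeaf (leaf ∷ L) ⟩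
      localM (leaf ∷ leaf ∷ L) * (Mw leaf * productOver Mw L)
        ≈⟨ *-congˡ (≈-trans (*-congʳ Mweight-leaf) (*-identityˡ _)) ⟩
      localM (leaf ∷ leaf ∷ L) * productOver Mw L
        ≈⟨ solve 4 (λ u v p g → con 1 :* (u :* con 1) :* con 1 :* p :* (v :* con 1) :* g
                                  := u :* v :* (p :* g)) ≈-refl u2 v2 _ _ ⟩
      u2 * v2 * (pow R v1 (leavesIn L) * productOver Mw L)
        ≈⟨ *-congˡ (productOver-leafOr v1 Mw Mweight-leaf L) ⟩
      u2 * v2 * productOver ψ L ∎

    Mweight-nonTwin : ∀ x xs L →
                      Mw (node (leaf ∷ node (x ∷ xs) ∷ L)) ≈ u3 * Mw (node (x ∷ xs)) * productOver ψ L
    Mweight-nonTwin x xs L = begin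
      Mw (node (leaf ∷ d ∷ L))
        ≈⟨ Mweight-leftLeaf (d ∷ L) ⟩
      localM (leaf ∷ d ∷ L) * (Mw d * productOver Mw L)
        ≈⟨ solve 4 (λ u m p g → con 1 :* con 1 :* (u :* con 1) :* p :* con 1 :* (m :* g)
                                  := u :* m :* (p :* g)) ≈-refl u3 (Mw d) _ _ ⟩
      u3 * Mw d * (pow R v1 (leavesIn L) * productOver Mw L)
        ≈⟨ *-congˡ (productOver-leafOr v1 Mw Mweight-leaf L) ⟩
      u3 * Mw d * productOver ψ L ∎
      where d = node (x ∷ xs)

  module FibreSums (x11 x12 x2 y11 y12 y2 u1 u2 u3 v1 v2 : Carrier)
                   (u1≈ : u1 ≈ x11 * y11) (u3≈ : u3 ≈ x12 * y12) (v1≈ : v1 ≈ x2 + y2)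
                   (u2v2≈ : u2 * v2 ≈ x12 * y12 * x2 + x11 * y11 * y2) where
    open Gweights x11 x12 x2 y11 y12 y2
    open Mweights u1 u2 u3 v1 v2

    private
      Gw Mw φ ψ : PTree → Carrier
      Gw = Gweight R x11 x12 x2 y11 y12 y2
      Mw = Mweight R u1 u2 u3 v1 v2
      φ  = leafOr x2 Gw
      ψ  = leafOr v1 Mw

    mutual
      grow-sum : ∀ {c rs} L → NotSingletonParent c rs → AllTipAug L →
                 sumOver R Gw (grow c rs L) ≈ Gw (node (c ∷ rs)) * productOver ψ L
      grow-sum []                             _  _        = ≈-trans (+-identityʳ _) (≈-sym (*-identityʳ _))
      grow-sum {c} {rs} (node [] ∷ L)          ns (_ ∷ tL) = begin
        sumOver R Gw (grow c (rs ++ [ leaf ]) L ++ grow (node (c ∷ rs)) [] L)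
          ≈⟨ sumOver-++ R Gw (grow c (rs ++ [ leaf ]) L) _ ⟩
        sumOver R Gw (grow c (rs ++ [ leaf ]) L) + sumOver R Gw (grow (node (c ∷ rs)) [] L)
          ≈⟨ +-cong (grow-sum L (notSingletonParent-snoc c rs leaf) tL) (grow-sum L interiorFirst tL) ⟩
        Gw (node (c ∷ rs ++ [ leaf ])) * productOver ψ L + Gw (node (node (c ∷ rs) ∷ [])) * productOver ψ L
          ≈⟨ +-cong (*-congʳ (Gweight-snoc leaf ns)) (*-congʳ (Gweight-youngInterior c rs [])) ⟩
        w * x2 * productOver ψ L + y2 * w * 1# * productOver ψ L
          ≈⟨ solve 4 (λ w x y p → w :* x :* p :+ y :* w :* con 1 :* p := w :* ((x :+ y) :* p)) ≈-refl w x2 y2 _ ⟩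
        w * ((x2 + y2) * productOver ψ L)
          ≈⟨ *-congˡ (*-congʳ v1≈) ⟨
        w * (v1 * productOver ψ L) ∎
        where w = Gw (node (c ∷ rs))
      grow-sum {c} {rs} (d@(node (_ ∷ _)) ∷ L) ns (td ∷ tL) = begin
        sumOver R Gw (concatMap (λ t → grow c (rs ++ [ t ]) L) (Φ⁻¹ d))
          ≈⟨ sumOver-concatMap R Gw _ (Φ⁻¹ d) ⟩
        sumOver R (λ t → sumOver R Gw (grow c (rs ++ [ t ]) L)) (Φ⁻¹ d)
          ≈⟨ sumOver-cong R (Φ⁻¹ d) (λ {t} _ → ≈-trans (grow-sum L (notSingletonParent-snoc c rs t) tL)
                                                        (*-congʳ (Gweight-snoc t ns))) ⟩
        sumOver R (λ t → w * φ t * productOver ψ L) (Φ⁻¹ d)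
          ≈⟨ sumOver-cong R (Φ⁻¹ d) (λ _ → xy∙z≈y∙xz _ _ _) ⟩
        sumOver R (λ t → φ t * (w * productOver ψ L)) (Φ⁻¹ d)
          ≈⟨ Φ⁻¹-sum-interior _ td ⟩
        Mw d * (w * productOver ψ L)
          ≈⟨ x∙yz≈y∙xz _ _ _ ⟩
        w * (Mw d * productOver ψ L) ∎
        where w = Gw (node (c ∷ rs))

      Φ⁻¹-sum-interior : ∀ {x xs} k → TipAug (node (x ∷ xs)) →
                         sumOver R (λ t → φ t * k) (Φ⁻¹ (node (x ∷ xs))) ≈ Mw (node (x ∷ xs)) * k
      Φ⁻¹-sum-interior {x} {xs} k td = begin
        sumOver R (λ t → φ t * k) (Φ⁻¹ d)  ≈⟨ sumOver-cong R (Φ⁻¹ d) (λ t∈ → *-congʳ (reflexive (leafOr-Φ⁻¹ x2 Gw x xs t∈))) ⟩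
        sumOver R (λ t → Gw t * k) (Φ⁻¹ d) ≈⟨ sumOver-*ʳ R Gw k (Φ⁻¹ d) ⟩
        sumOver R Gw (Φ⁻¹ d) * k           ≈⟨ *-congʳ (Φ⁻¹-sum td) ⟩
        Mw d * k                           ∎
        where d = node (x ∷ xs)

      Φ⁻¹-sum : ∀ {T} → TipAug T → sumOver R Gw (Φ⁻¹ T) ≈ Mw T
      Φ⁻¹-sum {node []} _ = begin
        Gw leaf + 0# ≈⟨ +-identityʳ _ ⟩
        Gw leaf      ≈⟨ Gweight-leaf ⟩
        1#           ≈⟨ Mweight-leaf ⟨
        Mw leaf      ∎
      Φ⁻¹-sum {node (node [] ∷ [])} _ = begin
        Gw (node [ leaf ]) + 0# ≈⟨ +-identityʳ _ ⟩
        Gw (node [ leaf ])      ≈⟨ Gweight-singleton ⟩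
        x11 * y11               ≈⟨ u1≈ ⟨
        u1                      ≈⟨ Mweight-singleton ⟨
        Mw (node [ leaf ])      ∎
      Φ⁻¹-sum {node (node [] ∷ node [] ∷ L)} (tip _ (_ ∷ _ ∷ tL)) = begin
        sumOver R Gw (grow leaf [ leaf ] L ++ grow (node [ leaf ]) [] L)
          ≈⟨ sumOver-++ R Gw (grow leaf [ leaf ] L) _ ⟩
        sumOver R Gw (grow leaf [ leaf ] L) + sumOver R Gw (grow (node [ leaf ]) [] L)
          ≈⟨ +-cong (grow-sum L hasSibling tL) (grow-sum L interiorFirst tL) ⟩
        Gw (node (leaf ∷ [ leaf ])) * productOver ψ L + Gw (node [ node [ leaf ] ]) * productOver ψ L
          ≈⟨ +-cong (*-congʳ (Gweight-elder leaf []))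
                    (*-congʳ (≈-trans (Gweight-youngInterior leaf [] []) (*-congʳ (*-congˡ Gweight-singleton)))) ⟩
        x12 * y12 * (x2 * 1#) * productOver ψ L + y2 * (x11 * y11) * 1# * productOver ψ L
          ≈⟨ solve 7 (λ a b x c d y p → a :* b :* (x :* con 1) :* p :+ y :* (c :* d) :* con 1 :* p
                                          := (a :* b :* x :+ c :* d :* y) :* p) ≈-refl x12 y12 x2 x11 y11 y2 _ ⟩
        (x12 * y12 * x2 + x11 * y11 * y2) * productOver ψ L
          ≈⟨ *-congʳ u2v2≈ ⟨
        u2 * v2 * productOver ψ L
          ≈⟨ Mweight-twin L ⟨
        Mw (node (leaf ∷ leaf ∷ L)) ∎
      Φ⁻¹-sum {node (node [] ∷ d@(node (x ∷ xs)) ∷ L)} (tip _ (_ ∷ td ∷ tL)) = begin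
        sumOver R Gw (concatMap (λ t → grow leaf [ t ] L) (Φ⁻¹ d))
          ≈⟨ sumOver-concatMap R Gw _ (Φ⁻¹ d) ⟩
        sumOver R (λ t → sumOver R Gw (grow leaf [ t ] L)) (Φ⁻¹ d)
          ≈⟨ sumOver-cong R (Φ⁻¹ d) (λ {t} _ → ≈-trans (grow-sum L hasSibling tL) (*-congʳ (Gweight-elder t []))) ⟩
        sumOver R (λ t → x12 * y12 * (φ t * 1#) * productOver ψ L) (Φ⁻¹ d)
          ≈⟨ sumOver-cong R (Φ⁻¹ d) (λ {t} _ → solve 4 (λ a b f p → a :* b :* (f :* con 1) :* p
                                                                      := f :* (a :* b :* p)) ≈-refl x12 y12 (φ t) _) ⟩
        sumOver R (λ t → φ t * (x12 * y12 * productOver ψ L)) (Φ⁻¹ d)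
          ≈⟨ Φ⁻¹-sum-interior _ td ⟩
        Mw d * (x12 * y12 * productOver ψ L)
          ≈⟨ solve 4 (λ m a b p → m :* (a :* b :* p) := a :* b :* m :* p) ≈-refl (Mw d) x12 y12 _ ⟩
        x12 * y12 * Mw d * productOver ψ L
          ≈⟨ *-congʳ (*-congʳ u3≈) ⟨
        u3 * Mw d * productOver ψ L
          ≈⟨ Mweight-nonTwin x xs L ⟨
        Mw (node (leaf ∷ d ∷ L)) ∎
      Φ⁻¹-sum {node (node (_ ∷ _) ∷ _)} (tip () _)

theorem1p20 : ∀ {c ℓ} (R : CommutativeRing c ℓ) →
    let open CommutativeRing R in
    (n : ℕ) → 1 ≤ n →
    (x11 x12 x2 y11 y12 y2 u1 u2 u3 v1 v2 : Carrier) →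
    u1 ≈ x11 * y11 →
    u3 ≈ x12 * y12 →
    v1 ≈ x2 + y2 →
    u2 * v2 ≈ x12 * y12 * x2 + x11 * y11 * y2 →
    (Ps : List PTree) → IsEnumeration (λ T → edges T ≡ suc n) Ps →
    (Ts : List PTree) → IsEnumeration (λ T → TipAug T × edges T ≡ suc n) Ts →
    sumOver R (Gweight R x11 x12 x2 y11 y12 y2) Ps
      ≈ sumOver R (Mweight R u1 u2 u3 v1 v2) Ts
theorem1p20 R n _ x11 x12 x2 y11 y12 y2 u1 u2 u3 v1 v2 u1≈ u3≈ v1≈ u2v2≈ Ps Ps-enum Ts Ts-enum = begin
  sumOver R Gw Ps                           ≈⟨ sumOver-fibres R Φ Φ⁻¹ Φ⁻¹-isEnumeration Φ-preserves-size Gw Ps-enum Ts-enum ⟩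
  sumOver R (λ T → sumOver R Gw (Φ⁻¹ T)) Ts ≈⟨ sumOver-cong R Ts (λ T∈Ts → Φ⁻¹-sum (proj₁ (proj₁ (proj₂ Ts-enum) _ T∈Ts))) ⟩
  sumOver R (Mweight R u1 u2 u3 v1 v2) Ts   ∎
  where
  open CommutativeRing R using (setoid)
  open SetoidReasoning setoid
  open FibreSums R x11 x12 x2 y11 y12 y2 u1 u2 u3 v1 v2 u1≈ u3≈ v1≈ u2v2≈ using (Φ⁻¹-sum)

  Gw : PTree → CommutativeRing.Carrier R
  Gw = Gweight R x11 x12 x2 y11 y12 y2

  Φ-preserves-size : (λ T → edges T ≡ suc n) ≐ (λ T → TipAug T × edges T ≡ suc n) ∘ Φ
  Φ-preserves-size = (λ {T} e → Φ-tipAug T , trans (edges-Φ T) e) , (λ {T} (_ , e) → trans (sym (edges-Φ T)) e)
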